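{- There is an infinite class $\mathcal{G}$ of outerplanar graphs such that every $G\in\mathcal{G}$ satisfies: (i) $G$ is a near-triangulation, (ii) $\Delta(G)=5$, (iii) $\min_{v\in V(G)}\alpha_v(G)\ge\lfloor |G|/3\rfloor$, and (iv) $G$ has no equitable $3$-coloring.
   Context: A near-triangulation is a plane graph in which every bounded face is a triangle. For a graph $G$ and $v\in V(G)$, $\alpha_v(G)$ is the maximum size of an independent set containing $v$. A proper coloring of an $n$-vertex graph with colors $1,2,3$ is equitable if every color class has size $\lfloor n/3\rfloor$ or $\lceil n/3\rceil$. -}

module Defs where

open import Data.Nat using (ℕ; zero; suc; _+_; _≤_; _<_; _/_)
open import Data.Fin using (Fin; toℕ; _≟_)
open import Data.Fin.Permutation using (Permutation′; _⟨$⟩ʳ_)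
open import Data.Fin.Subset using (Subset; _∈_; ∣_∣)
open import Data.Bool using (Bool; true; false; if_then_else_)
open import Data.List using (List; allFin; map)
open import Data.Nat.ListAction using (sum)
open import Data.Product using (Σ; ∃; ∃-syntax; _×_)
open import Data.Sum using (_⊎_)
open import Relation.Nullary using (¬_; does)
open import Relation.Binary.PropositionalEquality using (_≡_; _≢_)

record Graph (n : ℕ) : Set where
  field
    adj     : Fin n → Fin n → Bool
    symm    : ∀ u v → adj u v ≡ adj v u
    irrefl  : ∀ v → adj v v ≡ false
open Graph public

degree : ∀ {n} → Graph n → Fin n → ℕ
degree {n} G v = sum (map (λ u → if adj G v u then 1 else 0) (allFin n))

MaxDegreeEq : ∀ {n} → Graph n → ℕ → Set
MaxDegreeEq G d = (∀ v → degree G v ≤ d) × ∃[ v ] (degree G v ≡ d)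

Independent : ∀ {n} → Graph n → Subset n → Set
Independent G S = ∀ u w → u ∈ S → w ∈ S → adj G u w ≡ false

AlphaAtLeast : ∀ {n} → Graph n → Fin n → ℕ → Set
AlphaAtLeast G v k = ∃[ S ] (Independent G S × v ∈ S × k ≤ ∣ S ∣)

Proper : ∀ {n k} → Graph n → (Fin n → Fin k) → Set
Proper G c = ∀ u w → adj G u w ≡ true → c u ≢ c w

classSize : ∀ {n k} → (Fin n → Fin k) → Fin k → ℕ
classSize {n} c i = sum (map (λ v → if does (c v ≟ i) then 1 else 0) (allFin n))

-- Equitable proper 3-colouring: every class has size ⌊n/3⌋ or ⌈n/3⌉ = ⌊(n+2)/3⌋.
EquitableThreeColouring : ∀ {n} → Graph n → (Fin n → Fin 3) → Set
EquitableThreeColouring {n} G c =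
  Proper G c × (∀ i → classSize c i ≡ n / 3 ⊎ classSize c i ≡ (n + 2) / 3)

-- Outerplane drawing: vertices placed on a circle at positions 0..n-1 (cyclic order),
-- edges drawn as straight chords.
-- x lies strictly between a and b (in the linear order of positions).
Between : ℕ → ℕ → ℕ → Set
Between x a b = (a < x × x < b) ⊎ (b < x × x < a)

Cross : ℕ → ℕ → ℕ → ℕ → Set
Cross a b c d =
    (Between c a b × ¬ Between d a b × d ≢ a × d ≢ b)
  ⊎ (Between d a b × ¬ Between c a b × c ≢ a × c ≢ b)

-- G is an outerplanar near-triangulation: n ≥ 3 and there is a cyclic ordering σ
-- (position ↦ vertex) of all vertices on a circle such that
--  * consecutive vertices are adjacent (the outer face is bounded by a Hamiltonian cycle),
--  * no two edges cross (outerplane embedding),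
--  * every bounded face is a triangle: every non-adjacent pair of distinct vertices is
--    separated by (crosses) some edge, i.e. no bounded face has a diagonal.
OuterplanarNearTriangulation : ∀ {n} → Graph n → Set
OuterplanarNearTriangulation {n} G = 3 ≤ n × Σ (Permutation′ n) λ σ →
  let E : Fin n → Fin n → Bool
      E i j = adj G (σ ⟨$⟩ʳ i) (σ ⟨$⟩ʳ j)
  in (∀ i j → (suc (toℕ i) ≡ toℕ j ⊎ (suc (toℕ i) ≡ n × toℕ j ≡ 0)) → E i j ≡ true)
   × (∀ i j k l → E i j ≡ true → E k l ≡ true → ¬ Cross (toℕ i) (toℕ j) (toℕ k) (toℕ l))
   × (∀ i j → i ≢ j → E i j ≡ false →
        ∃[ k ] ∃[ l ] (E k l ≡ true × Cross (toℕ i) (toℕ j) (toℕ k) (toℕ l)))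

-- The graph is a triangulated strip on the cycle 0, 1, …, n − 1 with n = 4R + 2 = 2N: the top path
-- 0 … N − 1 and the bottom path N … n − 1 are joined by the rungs {p, n − p}, and every even top vertex p
-- is also joined to n − p − 1 and n − p + 1, the bottom ends of the neighbouring rungs. Its maximum degree
-- is 5, and its vertices of degree 3, the apexes, form an independent set of size 2R. Deleting from it the
-- at most five neighbours of a vertex v and adding v gives an independent set through v of size
-- 2R − 5 ≥ ⌊n/3⌋. Consecutive apexes are the tips of a diamond (two triangles sharing an edge), and the
-- tips of a diamond receive equal colours in every proper 3-colouring; hence all 2R > ⌈n/3⌉ apexes lie in
-- one colour class.

module Submission where

open import Defs
open import Data.Nat using (ℕ; _≤_; _/_)
open import Data.Fin using (Fin)
open import Data.Product using (Σ; ∃-syntax; _×_)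
open import Relation.Nullary using (¬_)

open import Data.Bool as Bool using (Bool; true; false; not; _xor_; if_then_else_)
open import Data.Bool.Properties
  using (∨-comm; ¬-not; not-injective; not-involutive; not-distribˡ-xor; xor-same; xor-identityʳ)
open import Data.Empty using (⊥)
import Data.Fin as Fin
open import Data.Fin using (toℕ; fromℕ<)
open import Data.Fin.Properties using (toℕ-fromℕ<; fromℕ<-toℕ; toℕ-injective; toℕ<n; all?)
import Data.Fin.Permutation as Perm
open import Data.Fin.Subset using (Subset; _∈_; _∉_; _∪_; _─_; ⁅_⁆; ∣_∣; inside; outside)
open import Data.Fin.Subset.Properties
  using (x∈p∪q⁺; x∈p∪q⁻; x∈⁅x⁆; x∈⁅y⁆⇒x≡y; p─q⊆p; ∣p∣≤∣p∪q∣; p⊆q⇒∣p∣≤∣q∣)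
open import Data.List using (List; []; _∷_; _++_; length; map; allFin)
open import Data.List.Membership.Propositional using () renaming (_∈_ to _∈ˡ_)
open import Data.List.Membership.Propositional.Properties using (∈-∃++; ∈-++⁻; ∈-++⁺ˡ; ∈-++⁺ʳ)
open import Data.List.Properties using (length-++; map-tabulate)
open import Data.List.Relation.Unary.All as All using (All; []; _∷_)
open import Data.List.Relation.Unary.AllPairs using (AllPairs; []; _∷_)
open import Data.List.Relation.Unary.Any using (here; there)
open import Data.List.Relation.Unary.Linked using ([-]; _∷_)
open import Data.List.Relation.Unary.Linked.Properties using (Linked⇒AllPairs)
open import Data.Nat using (zero; suc; pred; _+_; _*_; _∸_; _<_; _>_; z≤n; s≤s; z<s; s≤s⁻¹; _<?_)
open import Data.Nat.DivMod using (/-monoˡ-≤; m<n*o⇒m/o<n)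
open import Data.Nat.ListAction using (sum)
open import Data.Nat.Properties
open import Data.Nat.Tactic.RingSolver using (solve-∀)
open import Data.Product using (_,_; proj₁; proj₂)
open import Data.Sum using (_⊎_; inj₁; inj₂; swap)
open import Data.Vec using ([]; _∷_; tabulate; here; there)
open import Data.Vec.Properties using (lookup∘tabulate; []=⇒lookup; lookup⇒[]=)
open import Function using (_∘_)
open import Relation.Binary using (tri<; tri≈; tri>)
open import Relation.Binary.PropositionalEquality
open import Relation.Nullary using (Dec; yes; no; does; contradiction)
open import Relation.Nullary.Decidable
  using (map′; _⊎-dec_; _×-dec_; _→-dec_; ¬?; from-yes; dec-true; dec-false)

count : (ℕ → Bool) → ℕ → ℕ
count g zero = 0
count g (suc n) = count g n + (if g n then 1 else 0)

count-+ : ∀ (g : ℕ → Bool) m n → count g (m + n) ≡ count g m + count (λ k → g (m + k)) n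
count-+ g m zero rewrite +-identityʳ m = sym (+-identityʳ _)
count-+ g m (suc n) rewrite +-suc m n | count-+ g m n = +-assoc (count g m) _ _

count-cong : ∀ {f g : ℕ → Bool} n → (∀ k → k < n → f k ≡ g k) → count f n ≡ count g n
count-cong zero f≗g = refl
count-cong (suc n) f≗g =
  cong₂ (λ c b → c + (if b then 1 else 0)) (count-cong n (λ k k<n → f≗g k (m<n⇒m<1+n k<n))) (f≗g n ≤-refl)

sum-map-allFin-suc : ∀ n (h : Fin (suc n) → ℕ) →
  sum (map h (allFin (suc n))) ≡ h Fin.zero + sum (map (h ∘ Fin.suc) (allFin n))
sum-map-allFin-suc n h =
  cong (λ xs → h Fin.zero + sum xs) (trans (map-tabulate Fin.suc h) (sym (map-tabulate (λ i → i) (h ∘ Fin.suc))))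

sum-allFin≡count : ∀ n (g : ℕ → Bool) → sum (map (λ i → if g (toℕ i) then 1 else 0) (allFin n)) ≡ count g n
sum-allFin≡count zero g = refl
sum-allFin≡count (suc n) g = begin
  sum (map (λ i → if g (toℕ i) then 1 else 0) (allFin (suc n)))
    ≡⟨ sum-map-allFin-suc n _ ⟩
  count g 1 + sum (map (λ i → if g (suc (toℕ i)) then 1 else 0) (allFin n))
    ≡⟨ cong (count g 1 +_) (sum-allFin≡count n (λ k → g (suc k))) ⟩
  count g 1 + count (λ k → g (suc k)) n
    ≡⟨ sym (count-+ g 1 n) ⟩
  count g (suc n) ∎
  where open ≡-Reasoning

count-≤-length : ∀ n (g : ℕ → Bool) (L : List ℕ) →
  (∀ k → k < n → g k ≡ true → k ∈ˡ L) → count g n ≤ length L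
count-≤-length zero g L covers = z≤n
count-≤-length (suc n) g L covers with g n in gn
... | false = ≤-trans (≤-reflexive (+-identityʳ _)) (count-≤-length n g L (λ k k<n → covers k (m<n⇒m<1+n k<n)))
... | true with ys , zs , refl ← ∈-∃++ (covers n ≤-refl gn) = begin
  count g n + 1                  ≡⟨ +-comm _ 1 ⟩
  suc (count g n)                ≤⟨ s≤s (count-≤-length n g (ys ++ zs) covers′) ⟩
  suc (length (ys ++ zs))        ≡⟨ cong suc (length-++ ys) ⟩
  suc (length ys + length zs)    ≡⟨ sym (+-suc (length ys) _) ⟩
  length ys + length (n ∷ zs)    ≡⟨ sym (length-++ ys) ⟩
  length (ys ++ n ∷ zs)          ∎
  where
  open ≤-Reasoning
  covers′ : ∀ k → k < n → g k ≡ true → k ∈ˡ ys ++ zs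
  covers′ k k<n gk with ∈-++⁻ ys (covers k (m<n⇒m<1+n k<n) gk)
  ... | inj₁ k∈ys = ∈-++⁺ˡ k∈ys
  ... | inj₂ (here refl) = contradiction k<n (<-irrefl refl)
  ... | inj₂ (there k∈zs) = ∈-++⁺ʳ ys k∈zs

length-≤-count : ∀ n (g : ℕ → Bool) {L : List ℕ} →
  AllPairs _>_ L → All (λ k → k < n × g k ≡ true) L → length L ≤ count g n
length-≤-count n g [] [] = z≤n
length-≤-count (suc n) g {a ∷ L} (a>L ∷ decreasing) ((a<1+n , ga) ∷ rest) with m<1+n⇒m<n∨m≡n a<1+n
... | inj₁ a<n = ≤-trans (length-≤-count n g (a>L ∷ decreasing) ((a<n , ga) ∷ below)) (m≤m+n _ _)
  where
  below : All (λ k → k < n × g k ≡ true) L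
  below = All.zipWith (λ (k<a , gk) → <-trans k<a a<n , gk) (a>L , All.map proj₂ rest)
... | inj₂ refl rewrite ga = begin
  suc (length L)  ≤⟨ s≤s (length-≤-count n g decreasing (All.zip (a>L , All.map proj₂ rest))) ⟩
  suc (count g n) ≡⟨ +-comm 1 _ ⟩
  count g n + 1   ∎
  where open ≤-Reasoning

odd : ℕ → Bool
odd zero = false
odd (suc k) = not (odd k)

odd-+ : ∀ a b → odd (a + b) ≡ odd a xor odd b
odd-+ zero b = refl
odd-+ (suc a) b rewrite odd-+ a b = not-distribˡ-xor (odd a) (odd b)

odd-double : ∀ k → odd (k + k) ≡ false
odd-double k rewrite odd-+ k k = xor-same (odd k)

count-odd : ∀ k → count odd (k + k) ≡ k
count-odd zero = refl
count-odd (suc k) rewrite +-suc k k | odd-double k | count-odd k = trans (cong (_+ 1) (+-identityʳ k)) (+-comm k 1)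

odd⇒>0 : ∀ {p} → odd p ≡ true → 0 < p
odd⇒>0 {suc p} _ = z<s

odd⇒suc-double : ∀ {k} → odd k ≡ true → ∃[ i ] suc (i + i) ≡ k
odd⇒suc-double {suc zero} _ = zero , refl
odd⇒suc-double {suc (suc k)} odd-k+2 with i , refl ← odd⇒suc-double {k} (trans (sym (not-involutive (odd k))) odd-k+2) =
  suc i , cong (suc ∘ suc) (+-suc i i)

∈-tabulate⁻ : ∀ {n} (f : Fin n → Bool) {x} → x ∈ tabulate f → f x ≡ true
∈-tabulate⁻ f {x} x∈ = trans (sym (lookup∘tabulate f x)) ([]=⇒lookup x∈)

∈-tabulate⁺ : ∀ {n} (f : Fin n → Bool) {x} → f x ≡ true → x ∈ tabulate f
∈-tabulate⁺ f {x} fx = lookup⇒[]= x _ (trans (lookup∘tabulate f x) fx)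

∣tabulate∣≡sum : ∀ {n} (f : Fin n → Bool) → ∣ tabulate f ∣ ≡ sum (map (λ i → if f i then 1 else 0) (allFin n))
∣tabulate∣≡sum {zero} f = refl
∣tabulate∣≡sum {suc n} f rewrite sum-map-allFin-suc n (λ i → if f i then 1 else 0) with f Fin.zero
... | true  = cong suc (∣tabulate∣≡sum (f ∘ Fin.suc))
... | false = ∣tabulate∣≡sum (f ∘ Fin.suc)

∈─⇒∉ : ∀ {n} (p q : Subset n) {x} → x ∈ p ─ q → x ∉ q
∈─⇒∉ (_ ∷ p) (inside ∷ q) () here
∈─⇒∉ (_ ∷ p) (_ ∷ q) (there x∈p─q) (there x∈q) = ∈─⇒∉ p q x∈p─q x∈q

∣p∣≤∣p─q∣+∣q∣ : ∀ {n} (p q : Subset n) → ∣ p ∣ ≤ ∣ p ─ q ∣ + ∣ q ∣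
∣p∣≤∣p─q∣+∣q∣ [] [] = z≤n
∣p∣≤∣p─q∣+∣q∣ (inside ∷ p) (inside ∷ q) = ≤-trans (s≤s (∣p∣≤∣p─q∣+∣q∣ p q)) (≤-reflexive (sym (+-suc _ _)))
∣p∣≤∣p─q∣+∣q∣ (outside ∷ p) (inside ∷ q) = ≤-trans (∣p∣≤∣p─q∣+∣q∣ p q) (+-monoʳ-≤ _ (n≤1+n _))
∣p∣≤∣p─q∣+∣q∣ (inside ∷ p) (outside ∷ q) = s≤s (∣p∣≤∣p─q∣+∣q∣ p q)
∣p∣≤∣p─q∣+∣q∣ (outside ∷ p) (outside ∷ q) = ∣p∣≤∣p─q∣+∣q∣ p q

module _ {n} (G : Graph n) where

  neighbourhood : Fin n → Subset n
  neighbourhood v = tabulate (adj G v)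

  independent⇒AlphaAtLeast : ∀ {I Δ k} → Independent G I → (∀ v → degree G v ≤ Δ) → k + Δ ≤ ∣ I ∣ →
    ∀ v → AlphaAtLeast G v k
  independent⇒AlphaAtLeast {I} {Δ} {k} I-independent degree≤Δ k+Δ≤∣I∣ v =
    S , S-independent , x∈p∪q⁺ (inj₂ (x∈⁅x⁆ v)) , k≤∣S∣
    where
    N = neighbourhood v
    S = (I ─ N) ∪ ⁅ v ⁆
    non-neighbour : ∀ {w} → w ∈ I ─ N → adj G v w ≡ false
    non-neighbour w∈I─N = ¬-not (λ vw → ∈─⇒∉ I N w∈I─N (∈-tabulate⁺ (adj G v) vw))
    S-independent : Independent G S
    S-independent u w u∈S w∈S with x∈p∪q⁻ (I ─ N) _ u∈S | x∈p∪q⁻ (I ─ N) _ w∈S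
    ... | inj₁ u∈ | inj₁ w∈ = I-independent u w (p─q⊆p I N u∈) (p─q⊆p I N w∈)
    ... | inj₂ u∈ | inj₁ w∈ rewrite x∈⁅y⁆⇒x≡y v u∈ = non-neighbour w∈
    ... | inj₁ u∈ | inj₂ w∈ rewrite x∈⁅y⁆⇒x≡y v w∈ = trans (symm G u v) (non-neighbour u∈)
    ... | inj₂ u∈ | inj₂ w∈ rewrite x∈⁅y⁆⇒x≡y v u∈ | x∈⁅y⁆⇒x≡y v w∈ = irrefl G v
    k≤∣S∣ : k ≤ ∣ S ∣
    k≤∣S∣ = +-cancelʳ-≤ Δ k ∣ S ∣ (begin
      k + Δ              ≤⟨ k+Δ≤∣I∣ ⟩
      ∣ I ∣              ≤⟨ ∣p∣≤∣p─q∣+∣q∣ I N ⟩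
      ∣ I ─ N ∣ + ∣ N ∣  ≤⟨ +-mono-≤ (∣p∣≤∣p∪q∣ (I ─ N) ⁅ v ⁆) (subst (_≤ Δ) (sym (∣tabulate∣≡sum (adj G v))) (degree≤Δ v)) ⟩
      ∣ S ∣ + Δ          ∎)
      where open ≤-Reasoning

  monochromatic⇒¬equitable : (I : Subset n) → (n + 2) / 3 < ∣ I ∣ →
    (∀ c → Proper G c → ∃[ i ] (∀ u → u ∈ I → c u ≡ i)) → ¬ (∃[ c ] EquitableThreeColouring G c)
  monochromatic⇒¬equitable I ⌈n/3⌉<∣I∣ monochromatic (c , proper , balanced)
    with i , I⊆class ← monochromatic c proper =
    <⇒≱ ⌈n/3⌉<∣I∣ (≤-trans ∣I∣≤class (class≤⌈n/3⌉ (balanced i)))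
    where
    ∣I∣≤class : ∣ I ∣ ≤ classSize c i
    ∣I∣≤class = ≤-trans (p⊆q⇒∣p∣≤∣q∣ (λ u∈I → ∈-tabulate⁺ _ (dec-true (c _ Fin.≟ i) (I⊆class _ u∈I))))
                        (≤-reflexive (∣tabulate∣≡sum (λ u → does (c u Fin.≟ i))))
    class≤⌈n/3⌉ : classSize c i ≡ n / 3 ⊎ classSize c i ≡ (n + 2) / 3 → classSize c i ≤ (n + 2) / 3
    class≤⌈n/3⌉ (inj₁ ≡⌊n/3⌋) = ≤-trans (≤-reflexive ≡⌊n/3⌋) (/-monoˡ-≤ 3 (m≤m+n n 2))
    class≤⌈n/3⌉ (inj₂ ≡⌈n/3⌉) = ≤-reflexive ≡⌈n/3⌉

same-third-colour : (a b x y : Fin 3) → a ≢ b → x ≢ a → x ≢ b → y ≢ a → y ≢ b → x ≡ y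
same-third-colour = from-yes same-third-colour?
  where
  same-third-colour? : Dec ((a b x y : Fin 3) → a ≢ b → x ≢ a → x ≢ b → y ≢ a → y ≢ b → x ≡ y)
  same-third-colour? = all? λ a → all? λ b → all? λ x → all? λ y →
    ¬? (a Fin.≟ b) →-dec ¬? (x Fin.≟ a) →-dec ¬? (x Fin.≟ b) →-dec ¬? (y Fin.≟ a) →-dec ¬? (y Fin.≟ b) →-dec x Fin.≟ y

does-true : ∀ {A : Set} (a? : Dec A) → does a? ≡ true → A
does-true (yes a) _ = a

2+n≢n : ∀ {m} → suc (suc m) ≢ m
2+n≢n e = <⇒≢ (m<n⇒m<1+n (n<1+n _)) (sym e)

-- Chords of a circle

Between-sym : ∀ {x a b} → Between x a b → Between x b a
Between-sym (inj₁ a<x<b) = inj₂ a<x<b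
Between-sym (inj₂ b<x<a) = inj₁ b<x<a

Between⇒< : ∀ {x a b} → a < b → Between x a b → a < x × x < b
Between⇒< a<b (inj₁ a<x<b) = a<x<b
Between⇒< a<b (inj₂ (b<x , x<a)) = contradiction (<-trans b<x x<a) (<-asym a<b)

¬Between-above : ∀ {x a b} → a < b → b < x → ¬ Between x a b
¬Between-above a<b b<x between = <-asym b<x (proj₂ (Between⇒< a<b between))

¬Between-below : ∀ {x a b} → a < b → x < a → ¬ Between x a b
¬Between-below a<b x<a between = <-asym x<a (proj₁ (Between⇒< a<b between))

Cross-symˡ : ∀ {a b c d} → Cross a b c d → Cross b a c d
Cross-symˡ (inj₁ (c∈ , d∉ , d≢a , d≢b)) = inj₁ (Between-sym c∈ , d∉ ∘ Between-sym , d≢b , d≢a)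
Cross-symˡ (inj₂ (d∈ , c∉ , c≢a , c≢b)) = inj₂ (Between-sym d∈ , c∉ ∘ Between-sym , c≢b , c≢a)

Cross-symʳ : ∀ {a b c d} → Cross a b c d → Cross a b d c
Cross-symʳ (inj₁ crossing) = inj₂ crossing
Cross-symʳ (inj₂ crossing) = inj₁ crossing

Cross-inner : ∀ {a b c d} → a < c → c < b → b < d → Cross a b c d
Cross-inner a<c c<b b<d = inj₁ (inj₁ (a<c , c<b) , ¬Between-above a<b b<d , >⇒≢ (<-trans a<b b<d) , >⇒≢ b<d)
  where a<b = <-trans a<c c<b

Cross-outer : ∀ {a b c d} → c < a → a < d → d < b → Cross a b c d
Cross-outer c<a a<d d<b = inj₂ (inj₁ (a<d , d<b) , ¬Between-below a<b c<a , <⇒≢ c<a , <⇒≢ (<-trans c<a a<b))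
  where a<b = <-trans a<d d<b

Cross⇒interleaved : ∀ {a b c d} → a < b → c < d → Cross a b c d →
  (a < c × c < b × b < d) ⊎ (c < a × a < d × d < b)
Cross⇒interleaved {a} {b} {c} {d} a<b c<d (inj₁ (c∈ , d∉ , d≢a , d≢b)) with Between⇒< a<b c∈ | <-cmp d b
... | a<c , c<b | tri< d<b _ _ = contradiction (inj₁ (<-trans a<c c<d , d<b)) d∉
... | _         | tri≈ _ d≡b _ = contradiction d≡b d≢b
... | a<c , c<b | tri> _ _ b<d = inj₁ (a<c , c<b , b<d)
Cross⇒interleaved {a} {b} {c} {d} a<b c<d (inj₂ (d∈ , c∉ , c≢a , c≢b)) with Between⇒< a<b d∈ | <-cmp c a
... | a<d , d<b | tri< c<a _ _ = inj₂ (c<a , a<d , d<b)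
... | _         | tri≈ _ c≡a _ = contradiction c≡a c≢a
... | a<d , d<b | tri> _ _ a<c = contradiction (inj₁ (a<c , <-trans c<d d<b)) c∉

-- The triangulated strip

module Strip (R : ℕ) where

  N n : ℕ
  N = suc (R + R)
  n = N + N

  -- Chords are oriented p < q. The closing edge {0, n − 1} of the boundary cycle is diag⁻ at p = 0.
  data Chord : ℕ → ℕ → Set where
    side  : ∀ p → Chord p (suc p)
    rung  : ∀ {p q} → p < q → p + q ≡ n → Chord p q
    diag⁻ : ∀ {p q} → odd p ≡ false → p < q → suc (p + q) ≡ n → Chord p q
    diag⁺ : ∀ {p q} → odd p ≡ false → p < q → p + q ≡ suc n → Chord p q

  chord-< : ∀ {p q} → Chord p q → p < q
  chord-< (side p) = ≤-refl
  chord-< (rung p<q _) = p<q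
  chord-< (diag⁻ _ p<q _) = p<q
  chord-< (diag⁺ _ p<q _) = p<q

  chord? : ∀ p q → Dec (Chord p q)
  chord? p q = map′
    (λ { (inj₁ refl) → side p
       ; (inj₂ (p<q , inj₁ e)) → rung p<q e
       ; (inj₂ (p<q , inj₂ (even , inj₁ e))) → diag⁻ even p<q e
       ; (inj₂ (p<q , inj₂ (even , inj₂ e))) → diag⁺ even p<q e })
    (λ { (side p) → inj₁ refl
       ; (rung p<q e) → inj₂ (p<q , inj₁ e)
       ; (diag⁻ even p<q e) → inj₂ (p<q , inj₂ (even , inj₁ e))
       ; (diag⁺ even p<q e) → inj₂ (p<q , inj₂ (even , inj₂ e)) })
    (suc p ≟ q ⊎-dec p <? q ×-dec (p + q ≟ n ⊎-dec odd p Bool.≟ false ×-dec (suc (p + q) ≟ n ⊎-dec p + q ≟ suc n)))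

  Adjacent : ℕ → ℕ → Set
  Adjacent p q = Chord p q ⊎ Chord q p

  adjacent? : ∀ p q → Dec (Adjacent p q)
  adjacent? p q = chord? p q ⊎-dec chord? q p

  ¬Adjacent-refl : ∀ p → ¬ Adjacent p p
  ¬Adjacent-refl p (inj₁ c) = <-irrefl refl (chord-< c)
  ¬Adjacent-refl p (inj₂ c) = <-irrefl refl (chord-< c)

  strip : Graph n
  strip = record
    { adj    = λ u v → does (adjacent? (toℕ u) (toℕ v))
    ; symm   = λ u v → ∨-comm (does (chord? (toℕ u) (toℕ v))) _
    ; irrefl = λ v → dec-false (adjacent? (toℕ v) (toℕ v)) (¬Adjacent-refl (toℕ v))
    }

  long-chord-sum : ∀ {p q} → Chord p q → suc p < q → n ≤ suc (p + q) × p + q ≤ suc n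
  long-chord-sum (side p) long = contradiction long (<-irrefl refl)
  long-chord-sum (rung _ e) _ = ≤-trans (≤-reflexive (sym e)) (n≤1+n _) , ≤-trans (≤-reflexive e) (n≤1+n n)
  long-chord-sum (diag⁻ _ _ e) _ = ≤-reflexive (sym e) , ≤-trans (n≤1+n _) (≤-trans (≤-reflexive e) (n≤1+n n))
  long-chord-sum (diag⁺ _ _ e) _ = m≤n⇒m≤1+n (≤-trans (n≤1+n n) (≤-reflexive (sym e))) , ≤-reflexive e

  long-chord-even-below : ∀ {p q} → Chord p q → suc p < q → suc (p + q) ≡ n → odd p ≡ false
  long-chord-even-below (side p) long _ = contradiction long (<-irrefl refl)
  long-chord-even-below (rung _ e) _ e′ = contradiction (trans e′ (sym e)) 1+n≢n
  long-chord-even-below (diag⁻ even _ _) _ _ = even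
  long-chord-even-below (diag⁺ _ _ e) _ e′ = contradiction (trans (cong suc (sym e)) e′) 2+n≢n

  long-chord-even-above : ∀ {p q} → Chord p q → suc p < q → p + q ≡ suc n → odd p ≡ false
  long-chord-even-above (side p) long _ = contradiction long (<-irrefl refl)
  long-chord-even-above (rung _ e) _ e′ = contradiction (trans (sym e′) e) 1+n≢n
  long-chord-even-above (diag⁻ _ _ e) _ e′ = contradiction (trans (cong suc (sym e′)) e) 2+n≢n
  long-chord-even-above (diag⁺ even _ _) _ _ = even

  -- Except for sides, chords have endpoint sums n − 1, n or n + 1, and interleaving raises the sum by at
  -- least two. So xy is a diag⁻ and zw a diag⁺ with z = x + 1, and x, z cannot both be even.
  interleaved-chords : ∀ {x y z w} → Chord x y → Chord z w → x < z → z < y → y < w → ⊥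
  interleaved-chords {x} {y} {z} {w} xy zw x<z z<y y<w =
    contradiction (long-chord-even-above zw z-long z+w≡1+n) (subst (λ t → odd t ≢ false) (sym z≡1+x) odd-1+x)
    where
    x-long : suc x < y
    x-long = ≤-trans (s≤s x<z) z<y
    z-long : suc z < w
    z-long = ≤-trans (s≤s z<y) y<w
    outer≤1+n : z + w ≤ suc n
    outer≤1+n = proj₂ (long-chord-sum zw z-long)
    1+n≤inner+2 : suc n ≤ suc x + suc y
    1+n≤inner+2 = ≤-trans (s≤s (proj₁ (long-chord-sum xy x-long))) (≤-reflexive (cong suc (sym (+-suc x y))))
    inner+2≤outer : suc x + suc y ≤ z + w
    inner+2≤outer = +-mono-≤ x<z y<w
    z+w≡1+n : z + w ≡ suc n
    z+w≡1+n = ≤-antisym outer≤1+n (≤-trans 1+n≤inner+2 inner+2≤outer)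
    1+x+y≡n : suc (x + y) ≡ n
    1+x+y≡n = suc-injective (trans (cong suc (sym (+-suc x y))) (≤-antisym (≤-trans inner+2≤outer outer≤1+n) 1+n≤inner+2))
    z≡1+x : z ≡ suc x
    z≡1+x = ≤-antisym (+-cancelʳ-≤ (suc y) z (suc x) (≤-trans (+-monoʳ-≤ z y<w) (≤-trans outer≤1+n 1+n≤inner+2))) x<z
    odd-1+x : odd (suc x) ≢ false
    odd-1+x rewrite long-chord-even-below xy x-long 1+x+y≡n = λ ()

  chords-cross : ∀ {a b c d} → Chord a b → Chord c d → ¬ Cross a b c d
  chords-cross ab cd crossing with Cross⇒interleaved (chord-< ab) (chord-< cd) crossing
  ... | inj₁ (a<c , c<b , b<d) = interleaved-chords ab cd a<c c<b b<d
  ... | inj₂ (c<a , a<d , d<b) = interleaved-chords cd ab c<a a<d d<b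

  adjacent-cross : ∀ {a b c d} → Adjacent a b → Adjacent c d → ¬ Cross a b c d
  adjacent-cross (inj₁ ab) (inj₁ cd) = chords-cross ab cd
  adjacent-cross (inj₁ ab) (inj₂ dc) = chords-cross ab dc ∘ Cross-symʳ
  adjacent-cross (inj₂ ba) (inj₁ cd) = chords-cross ba cd ∘ Cross-symˡ
  adjacent-cross (inj₂ ba) (inj₂ dc) = chords-cross ba dc ∘ Cross-symˡ ∘ Cross-symʳ

  CrossedBy : ℕ → ℕ → Set
  CrossedBy p q = ∃[ k ] ∃[ l ] (Chord k l × l < n × Cross p q k l)

  crossed-sum<n-1 : ∀ {p q} → suc p < q → suc (p + q) < n → CrossedBy p q
  crossed-sum<n-1 {p} {q} p+1<q 1+p+q<n =
    suc p , l , rung (<-trans p+1<q q<l) 1+p+l≡n , l<n , Cross-inner ≤-refl p+1<q q<l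
    where
    l = n ∸ suc p
    1+p+l≡n : suc p + l ≡ n
    1+p+l≡n = m+[n∸m]≡n (≤-trans (m≤m+n (suc p) q) (<⇒≤ 1+p+q<n))
    q<l : q < l
    q<l = +-cancelˡ-< (suc p) q l (subst (suc p + q <_) (sym 1+p+l≡n) 1+p+q<n)
    l<n : l < n
    l<n = subst (l <_) 1+p+l≡n (m<n+m l z<s)

  crossed-sum≡n-1 : ∀ {p q} → suc p < q → suc (p + q) ≡ n → ¬ Adjacent p q → CrossedBy p q
  crossed-sum≡n-1 {p} {q} p+1<q 1+p+q≡n ¬adjacent with odd p in odd-p
  ... | false = contradiction (inj₁ (diag⁻ odd-p (<-trans (n<1+n p) p+1<q) 1+p+q≡n)) ¬adjacent
  ... | true =
    suc p , suc q , diag⁺ (cong not odd-p) (s≤s (<-trans (n<1+n p) p+1<q)) p+1+q+1≡n+1 , q+1<n , Cross-inner ≤-refl p+1<q ≤-refl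
    where
    p+1+q+1≡n+1 : suc p + suc q ≡ suc n
    p+1+q+1≡n+1 = cong suc (trans (+-suc p q) 1+p+q≡n)
    q+1<n : suc q < n
    q+1<n = subst (suc q <_) 1+p+q≡n (s≤s (m<n+m q (odd⇒>0 odd-p)))

  crossed-sum≡n+1 : ∀ {p q} → suc p < q → p + q ≡ suc n → q < n → ¬ Adjacent p q → CrossedBy p q
  crossed-sum≡n+1 {p} {q} p+1<q p+q≡n+1 q<n ¬adjacent with odd p in odd-p
  ... | false = contradiction (inj₁ (diag⁺ odd-p (<-trans (n<1+n p) p+1<q) p+q≡n+1)) ¬adjacent
  crossed-sum≡n+1 {suc p} {suc q} p+2<q+1 2+p+q≡n+1 q+1<n _ | true =
    p , q , diag⁻ (not-injective {y = false} odd-p) (<-trans (n<1+n p) p+1<q) 1+p+q≡n , <-trans (n<1+n q) q+1<n ,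
    Cross-outer ≤-refl p+1<q ≤-refl
    where
    p+1<q : suc p < q
    p+1<q = s≤s⁻¹ p+2<q+1
    1+p+q≡n : suc (p + q) ≡ n
    1+p+q≡n = suc-injective (trans (cong suc (sym (+-suc p q))) 2+p+q≡n+1)

  crossed-sum>n+1 : ∀ {p q} → suc p < q → suc n < p + q → q < n → CrossedBy p q
  crossed-sum>n+1 {p} {suc q} p+1<q+1 1+n<p+q+1 q+1<n =
    k , q , rung (<-trans k<p p<q) k+q≡n , <-trans (n<1+n q) q+1<n , Cross-outer k<p p<q ≤-refl
    where
    k = n ∸ q
    k+q≡n : k + q ≡ n
    k+q≡n = m∸n+n≡m (<⇒≤ (<-trans (n<1+n q) q+1<n))
    p<q : p < q
    p<q = s≤s⁻¹ p+1<q+1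
    k<p : k < p
    k<p = +-cancelʳ-< q k p (subst (_< p + q) (sym k+q≡n) (s≤s⁻¹ (subst (suc n <_) (+-suc p q) 1+n<p+q+1)))

  crossing-chord-< : ∀ {p q} → p < q → q < n → ¬ Adjacent p q → CrossedBy p q
  crossing-chord-< {p} {q} p<q q<n ¬adjacent with suc p ≟ q
  ... | yes refl = contradiction (inj₁ (side p)) ¬adjacent
  ... | no p+1≢q with ≤∧≢⇒< p<q p+1≢q | <-cmp (p + q) n
  ...   | _     | tri≈ _ p+q≡n _ = contradiction (inj₁ (rung p<q p+q≡n)) ¬adjacent
  ...   | p+1<q | tri< p+q<n _ _ with m≤n⇒m<n∨m≡n p+q<n
  ...     | inj₁ 1+p+q<n = crossed-sum<n-1 p+1<q 1+p+q<n
  ...     | inj₂ 1+p+q≡n = crossed-sum≡n-1 p+1<q 1+p+q≡n ¬adjacent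
  crossing-chord-< {p} {q} p<q q<n ¬adjacent | no _ | p+1<q | tri> _ _ n<p+q with m≤n⇒m<n∨m≡n n<p+q
  ...     | inj₁ 1+n<p+q = crossed-sum>n+1 p+1<q 1+n<p+q q<n
  ...     | inj₂ 1+n≡p+q = crossed-sum≡n+1 p+1<q (sym 1+n≡p+q) q<n ¬adjacent

  crossing-chord : ∀ {p q} → p ≢ q → p < n → q < n → ¬ Adjacent p q → CrossedBy p q
  crossing-chord {p} {q} p≢q p<n q<n ¬adjacent with <-cmp p q
  ... | tri< p<q _ _ = crossing-chord-< p<q q<n ¬adjacent
  ... | tri≈ _ p≡q _ = contradiction p≡q p≢q
  ... | tri> _ _ q<p with k , l , kl , l<n , crossing ← crossing-chord-< q<p p<n (¬adjacent ∘ swap) =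
    k , l , kl , l<n , Cross-symˡ crossing

  adj⇒Adjacent : ∀ {u v} → adj strip u v ≡ true → Adjacent (toℕ u) (toℕ v)
  adj⇒Adjacent {u} {v} = does-true (adjacent? (toℕ u) (toℕ v))

  Adjacent⇒adj : ∀ {u v} → Adjacent (toℕ u) (toℕ v) → adj strip u v ≡ true
  Adjacent⇒adj {u} {v} = dec-true (adjacent? (toℕ u) (toℕ v))

  non-adjacent : ∀ {u v} → adj strip u v ≡ false → ¬ Adjacent (toℕ u) (toℕ v)
  non-adjacent uv adjacent with () ← trans (sym (Adjacent⇒adj adjacent)) uv

  strip-outerplanar : 3 ≤ n → OuterplanarNearTriangulation strip
  strip-outerplanar 3≤n = 3≤n , Perm.id , boundary , non-crossing , triangulated
    where
    boundary : ∀ i j → suc (toℕ i) ≡ toℕ j ⊎ (suc (toℕ i) ≡ n × toℕ j ≡ 0) → adj strip i j ≡ true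
    boundary i j (inj₁ i+1≡j) = Adjacent⇒adj (inj₁ (subst (Chord (toℕ i)) i+1≡j (side (toℕ i))))
    boundary i j (inj₂ (i+1≡n , j≡0)) =
      Adjacent⇒adj (inj₂ (subst (λ t → Chord t (toℕ i)) (sym j≡0) (diag⁻ refl 0<i i+1≡n)))
      where
      0<i : 0 < toℕ i
      0<i = s≤s⁻¹ (≤-trans (s≤s (s≤s z≤n)) (≤-trans 3≤n (≤-reflexive (sym i+1≡n))))
    non-crossing : ∀ i j k l → adj strip i j ≡ true → adj strip k l ≡ true → ¬ Cross (toℕ i) (toℕ j) (toℕ k) (toℕ l)
    non-crossing i j k l ij kl = adjacent-cross (adj⇒Adjacent ij) (adj⇒Adjacent kl)
    chord-in-range : ∀ {p q} → CrossedBy p q → ∃[ k ] ∃[ l ] (adj strip k l ≡ true × Cross p q (toℕ k) (toℕ l))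
    chord-in-range (k , l , kl , l<n , crossing) =
      fromℕ< (<-trans (chord-< kl) l<n) , fromℕ< l<n ,
      Adjacent⇒adj (inj₁ (subst₂ Chord (sym (toℕ-fromℕ< _)) (sym (toℕ-fromℕ< _)) kl)) ,
      subst₂ (Cross _ _) (sym (toℕ-fromℕ< _)) (sym (toℕ-fromℕ< _)) crossing
    triangulated : ∀ i j → i ≢ j → adj strip i j ≡ false →
      ∃[ k ] ∃[ l ] (adj strip k l ≡ true × Cross (toℕ i) (toℕ j) (toℕ k) (toℕ l))
    triangulated i j i≢j ij =
      chord-in-range (crossing-chord (i≢j ∘ toℕ-injective) (toℕ<n i) (toℕ<n j) (non-adjacent ij))

  neighbours : ℕ → List ℕ
  neighbours p = suc p ∷ pred p ∷ n ∸ p ∷ n ∸ suc p ∷ suc n ∸ p ∷ []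

  Adjacent⇒∈neighbours : ∀ {p k} → Adjacent p k → k ∈ˡ neighbours p
  Adjacent⇒∈neighbours (inj₁ (side p)) = here refl
  Adjacent⇒∈neighbours {p} {k} (inj₁ (rung _ e)) = there (there (here (sym (trans (cong (_∸ p) (sym e)) (m+n∸m≡n p k)))))
  Adjacent⇒∈neighbours {p} {k} (inj₁ (diag⁻ _ _ e)) = there (there (there (here (sym (trans (cong (_∸ suc p) (sym e)) (m+n∸m≡n p k))))))
  Adjacent⇒∈neighbours {p} {k} (inj₁ (diag⁺ _ _ e)) = there (there (there (there (here (sym (trans (cong (_∸ p) (sym e)) (m+n∸m≡n p k)))))))
  Adjacent⇒∈neighbours (inj₂ (side k)) = there (here refl)
  Adjacent⇒∈neighbours {p} {k} (inj₂ (rung _ e)) = there (there (here (sym (trans (cong (_∸ p) (sym e)) (m+n∸n≡m k p)))))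
  Adjacent⇒∈neighbours {p} {k} (inj₂ (diag⁻ _ _ e)) = there (there (there (here (sym (trans (cong (_∸ suc p) (sym e)) (m+n∸n≡m k p))))))
  Adjacent⇒∈neighbours {p} {k} (inj₂ (diag⁺ _ _ e)) = there (there (there (there (here (sym (trans (cong (_∸ p) (sym e)) (m+n∸n≡m k p)))))))

  degree≡count : ∀ v → degree strip v ≡ count (λ k → does (adjacent? (toℕ v) k)) n
  degree≡count v = sum-allFin≡count n (λ k → does (adjacent? (toℕ v) k))

  degree≤5 : ∀ v → degree strip v ≤ 5
  degree≤5 v = subst (_≤ 5) (sym (degree≡count v))
    (count-≤-length n _ (neighbours (toℕ v)) λ k _ vk → Adjacent⇒∈neighbours (does-true (adjacent? (toℕ v) k) vk))

  max-degree-attained : 7 ≤ n → ∃[ v ] degree strip v ≡ 5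
  max-degree-attained 7≤n = v , ≤-antisym (degree≤5 v) (subst (5 ≤_) (sym (degree≡count v)) five-neighbours)
    where
    m = n ∸ 3
    n≡3+m : n ≡ 3 + m
    n≡3+m = sym (m+[n∸m]≡n (≤-trans (s≤s (s≤s (s≤s z≤n))) 7≤n))
    3<m : 3 < m
    3<m = m+n≤o⇒m≤o∸n 4 7≤n
    <n : ∀ {k} → k ≤ 2 + m → k < n
    <n {k} k≤2+m = subst (k <_) (sym n≡3+m) (s≤s k≤2+m)
    2<n : 2 < n
    2<n = <n (s≤s (s≤s z≤n))
    v = fromℕ< 2<n
    neighbour : ∀ {k} → k < n → Adjacent 2 k → k < n × does (adjacent? (toℕ v) k) ≡ true
    neighbour {k} k<n adjacent =
      k<n , subst (λ t → does (adjacent? t k) ≡ true) (sym (toℕ-fromℕ< 2<n)) (dec-true (adjacent? 2 k) adjacent)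
    2<m : 2 < m
    2<m = <-trans (n<1+n 2) 3<m
    five-neighbours : 5 ≤ count (λ k → does (adjacent? (toℕ v) k)) n
    five-neighbours = length-≤-count n _
      (Linked⇒AllPairs (λ b<a c<b → <-trans c<b b<a) (n<1+n (suc m) ∷ n<1+n m ∷ 3<m ∷ s≤s (s≤s z≤n) ∷ [-]))
      ( neighbour (<n ≤-refl) (inj₁ (diag⁺ refl (<-trans 2<m (<-trans (n<1+n m) (n<1+n (suc m)))) (cong suc (sym n≡3+m))))
      ∷ neighbour (<n (n≤1+n _)) (inj₁ (rung (<-trans 2<m (n<1+n m)) (sym n≡3+m)))
      ∷ neighbour (<n (m≤n+m m 2)) (inj₁ (diag⁻ refl 2<m (sym n≡3+m)))
      ∷ neighbour (<n (<⇒≤ (≤-trans 3<m (m≤n+m m 2)))) (inj₁ (side 2))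
      ∷ neighbour (<n (s≤s z≤n)) (inj₂ (side 1))
      ∷ [])

  odd-N : odd N ≡ true
  odd-N = cong not (odd-double R)

  -- The vertices of degree 3.
  apex : ℕ → Bool
  apex k = if does (k <? N) then odd k else odd (k ∸ N)

  apex-top : ∀ {k} → k < N → apex k ≡ odd k
  apex-top {k} k<N rewrite dec-true (k <? N) k<N = refl

  apex-bottom : ∀ t → apex (N + t) ≡ odd t
  apex-bottom t rewrite dec-false (N + t <? N) (m+n≮m N t) = cong odd (m+n∸m≡n N t)

  top-or-bottom : ∀ k → k < N ⊎ ∃[ t ] N + t ≡ k
  top-or-bottom k with k <? N
  ... | yes k<N = inj₁ k<N
  ... | no k≮N = inj₂ (m≤n⇒∃[o]m+o≡n (≮⇒≥ k≮N))

  apex-consecutive : ∀ p → apex p ≡ true → apex (suc p) ≡ false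
  apex-consecutive p apex-p with top-or-bottom p
  ... | inj₂ (t , refl) = trans (cong apex (sym (+-suc N t))) (trans (apex-bottom (suc t)) (cong not (trans (sym (apex-bottom t)) apex-p)))
  ... | inj₁ p<N with top-or-bottom (suc p)
  ...   | inj₁ p+1<N = trans (apex-top p+1<N) (cong not (trans (sym (apex-top p<N)) apex-p))
  ...   | inj₂ (t , N+t≡p+1) = begin
    apex (suc p) ≡⟨ cong apex (sym N+t≡p+1) ⟩
    apex (N + t) ≡⟨ apex-bottom t ⟩
    odd t        ≡⟨ cong odd t≡0 ⟩
    false        ∎
    where
    open ≡-Reasoning
    t≡0 : t ≡ 0
    t≡0 = n≤0⇒n≡0 (+-cancelˡ-≤ N t 0 (≤-trans (≤-reflexive N+t≡p+1) (≤-trans p<N (≤-reflexive (sym (+-identityʳ N))))))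

  long-chord-top : ∀ {p q} → Chord p q → suc p < q → p < N
  long-chord-top {p} {q} pq long with p <? N
  ... | yes p<N = p<N
  ... | no p≮N = contradiction (proj₂ (long-chord-sum pq long)) (<⇒≱ (begin-strict
    suc n                  <⟨ ≤-reflexive (sym (trans (+-suc N (suc N)) (cong suc (+-suc N N)))) ⟩
    N + suc (suc N)        ≤⟨ +-mono-≤ N≤p (≤-trans (s≤s (s≤s N≤p)) long) ⟩
    p + q                  ∎))
    where
    open ≤-Reasoning
    N≤p : N ≤ p
    N≤p = ≮⇒≥ p≮N

  apex-independent : ∀ {p q} → apex p ≡ true → apex q ≡ true → ¬ Chord p q
  apex-independent {p} {q} apex-p apex-q pq with suc p ≟ q
  ... | yes refl = contradiction (trans (sym apex-q) (apex-consecutive p apex-p)) λ ()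
  ... | no p+1≢q = long-apex pq (trans (sym (apex-top p<N)) apex-p)
    where
    long : suc p < q
    long = ≤∧≢⇒< (chord-< pq) p+1≢q
    p<N : p < N
    p<N = long-chord-top pq long
    long-apex : Chord p q → odd p ≡ true → ⊥
    long-apex (side p) _ = p+1≢q refl
    long-apex (diag⁻ even _ _) odd-p = contradiction (trans (sym even) odd-p) λ ()
    long-apex (diag⁺ even _ _) odd-p = contradiction (trans (sym even) odd-p) λ ()
    long-apex (rung _ p+q≡n) odd-p with top-or-bottom q
    ... | inj₁ q<N = contradiction p+q≡n (<⇒≢ (+-mono-< p<N q<N))
    ... | inj₂ (t , refl) = contradiction odd-N (subst (λ k → odd k ≢ true) p+t≡N odd-p+t)
      where
      p+t≡N : p + t ≡ N
      p+t≡N = +-cancelʳ-≡ N (p + t) N (trans (+-assoc p t N) (trans (cong (p +_) (+-comm t N)) p+q≡n))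
      odd-p+t : odd (p + t) ≢ true
      odd-p+t rewrite odd-+ p t | odd-p | trans (sym (apex-bottom t)) apex-q = λ ()

  count-apex : count apex n ≡ R + R
  count-apex = begin
    count apex (N + N)                            ≡⟨ count-+ apex N N ⟩
    count apex N + count (λ t → apex (N + t)) N   ≡⟨ cong₂ _+_ (count-cong N (λ k k<N → apex-top k<N)) (count-cong N (λ t _ → apex-bottom t)) ⟩
    count odd N + count odd N                     ≡⟨ cong₂ _+_ count-odd-N count-odd-N ⟩
    R + R                                         ∎
    where
    open ≡-Reasoning
    count-odd-N : count odd N ≡ R
    count-odd-N rewrite odd-double R = trans (+-identityʳ _) (count-odd R)

  top-< : ∀ {p q} → p < N → n ≤ suc (p + q) → p < q
  top-< {p} {q} p<N n≤1+p+q with p <? q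
  ... | yes p<q = p<q
  ... | no p≮q = contradiction n≤1+p+q (<⇒≱ (begin-strict
    suc (p + q)          ≤⟨ s≤s (+-monoʳ-≤ p (≮⇒≥ p≮q)) ⟩
    suc (p + p)          <⟨ ≤-reflexive (cong suc (sym (+-suc p p))) ⟩
    suc p + suc p        ≤⟨ +-mono-≤ p<N p<N ⟩
    n                    ∎))
    where open ≤-Reasoning

  module Colouring (c : Fin n → Fin 3) (proper : Proper strip c) where

    -- Positions outside the graph get the junk colour 0.
    colourAt : ℕ → Fin 3
    colourAt k with k <? n
    ... | yes k<n = c (fromℕ< k<n)
    ... | no _ = Fin.zero

    colourAt-toℕ : ∀ u → colourAt (toℕ u) ≡ c u
    colourAt-toℕ u with toℕ u <? n
    ... | yes u<n = cong c (fromℕ<-toℕ u u<n)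
    ... | no u≮n = contradiction (toℕ<n u) u≮n

    colourAt-adjacent : ∀ {p q} → Adjacent p q → p < n → q < n → colourAt p ≢ colourAt q
    colourAt-adjacent {p} {q} pq p<n q<n with p <? n | q <? n
    ... | yes p<n′ | yes q<n′ = proper (fromℕ< p<n′) (fromℕ< q<n′) (Adjacent⇒adj (subst₂ Adjacent (sym (toℕ-fromℕ< p<n′)) (sym (toℕ-fromℕ< q<n′)) pq))
    ... | no p≮n | _ = contradiction p<n p≮n
    ... | _ | no q≮n = contradiction q<n q≮n

    diamond : ∀ {a b x y} → Adjacent a b → Adjacent x a → Adjacent x b → Adjacent y a → Adjacent y b →
      a < n → b < n → x < n → y < n → colourAt x ≡ colourAt y
    diamond ab xa xb ya yb a<n b<n x<n y<n = same-third-colour _ _ _ _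
      (colourAt-adjacent ab a<n b<n) (colourAt-adjacent xa x<n a<n) (colourAt-adjacent xb x<n b<n)
      (colourAt-adjacent ya y<n a<n) (colourAt-adjacent yb y<n b<n)

    N<n : ∀ {k} → k < N → k < n
    N<n k<N = <-≤-trans k<N (m≤m+n N N)

    -- x and y are the tips of the two triangles on the diagonal {x + 1, y + 1}.
    diamond-across : ∀ {x y} → odd x ≡ true → suc x < N → suc (x + y) ≡ n → colourAt x ≡ colourAt y
    diamond-across {x} {y} odd-x x+1<N 1+x+y≡n =
      diamond (inj₁ (diag⁺ (cong not odd-x) (s≤s (<-trans (n<1+n x) x+1<y)) (cong suc x+1+y≡n))) (inj₁ (side x)) (inj₁ (rung x<y+1 x+1+y≡n))
              (inj₂ (rung x+1<y 1+x+y≡n)) (inj₁ (side y))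
              (N<n x+1<N) y+1<n (N<n (<-trans (n<1+n x) x+1<N)) (<-trans (n<1+n y) y+1<n)
      where
      x+1+y≡n : x + suc y ≡ n
      x+1+y≡n = trans (+-suc x y) 1+x+y≡n
      x+1<y : suc x < y
      x+1<y = top-< x+1<N (≤-trans (≤-reflexive (sym 1+x+y≡n)) (n≤1+n _))
      x<y+1 : x < suc y
      x<y+1 = <-trans (n<1+n x) (<-trans x+1<y (n<1+n y))
      y+1<n : suc y < n
      y+1<n = subst (suc y <_) 1+x+y≡n (s≤s (m<n+m y (odd⇒>0 odd-x)))

    -- x + 2 and y are the tips of the two triangles on the diagonal {x + 1, y − 1}.
    diamond-along : ∀ {x y} → odd x ≡ true → suc (suc x) < N → suc (x + y) ≡ n → colourAt (suc (suc x)) ≡ colourAt y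
    diamond-along {x} {zero} _ x+2<N 1+x+0≡n =
      contradiction 1+x+0≡n (<⇒≢ (N<n (subst (λ k → suc k < N) (sym (+-identityʳ x)) (<-trans (n<1+n _) x+2<N))))
    diamond-along {x} {suc y} odd-x x+2<N 2+x+y≡n =
      diamond (inj₁ (diag⁻ (cong not odd-x) x+1<y 2+x+y≡n′)) (inj₂ (side (suc x))) (inj₁ (rung x+2<y 2+x+y≡n′))
              (inj₂ (rung (s≤s (<-trans (n<1+n x) x+1<y)) 2+x+y≡n)) (inj₂ (side y))
              (N<n (<-trans (n<1+n _) x+2<N)) (<-trans (n<1+n y) y+1<n) (N<n x+2<N) y+1<n
      where
      2+x+y≡n′ : suc (suc (x + y)) ≡ n
      2+x+y≡n′ = trans (cong suc (sym (+-suc x y))) 2+x+y≡n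
      x+2<y : suc (suc x) < y
      x+2<y = top-< x+2<N (≤-trans (≤-reflexive (sym 2+x+y≡n′)) (n≤1+n _))
      x+1<y : suc x < y
      x+1<y = <-trans (n<1+n (suc x)) x+2<y
      y+1<n : suc y < n
      y+1<n = subst (suc y <_) 2+x+y≡n (s≤s (m≤n+m (suc y) x))

    top-apex-colour : ∀ i → suc (i + i) < N → colourAt (suc (i + i)) ≡ colourAt 1
    top-apex-colour zero _ = refl
    top-apex-colour (suc i) 2i+3<N = begin
      colourAt (suc (suc i + suc i)) ≡⟨ cong (colourAt ∘ suc ∘ suc) (+-suc i i) ⟩
      colourAt (suc (suc x))         ≡⟨ diamond-along odd-x x+2<N 1+x+y≡n ⟩
      colourAt y                     ≡⟨ sym (diamond-across odd-x (<-trans (n<1+n _) x+2<N) 1+x+y≡n) ⟩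
      colourAt x                     ≡⟨ top-apex-colour i (<-trans (n<1+n _) (<-trans (n<1+n _) x+2<N)) ⟩
      colourAt 1                     ∎
      where
      open ≡-Reasoning
      x = suc (i + i)
      odd-x : odd x ≡ true
      odd-x = cong not (odd-double i)
      x+2<N : suc (suc x) < N
      x+2<N = subst (λ k → suc (suc k) < N) (+-suc i i) 2i+3<N
      y = n ∸ suc x
      1+x+y≡n : suc (x + y) ≡ n
      1+x+y≡n = m+[n∸m]≡n (<⇒≤ (N<n (<-trans (n<1+n _) x+2<N)))

    odd-top-colour : ∀ {k} → k < N → odd k ≡ true → colourAt k ≡ colourAt 1
    odd-top-colour {k} k<N odd-k with i , refl ← odd⇒suc-double {k} odd-k = top-apex-colour i k<N

    apex-colour : ∀ k → k < n → apex k ≡ true → colourAt k ≡ colourAt 1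
    apex-colour k k<n apex-k with top-or-bottom k
    ... | inj₁ k<N = odd-top-colour k<N (trans (sym (apex-top k<N)) apex-k)
    ... | inj₂ (t , refl) = trans (sym (diamond-across odd-x x+1<N 1+x+k≡n)) (odd-top-colour (<-trans (n<1+n x) x+1<N) odd-x)
      where
      odd-t : odd t ≡ true
      odd-t = trans (sym (apex-bottom t)) apex-k
      t<N : t < N
      t<N = +-cancelˡ-< N t N k<n
      x = N ∸ suc t
      x+1+t≡N : x + suc t ≡ N
      x+1+t≡N = m∸n+n≡m t<N
      odd-x : odd x ≡ true
      odd-x = begin
        odd x                    ≡⟨ sym (xor-identityʳ (odd x)) ⟩
        odd x xor not true       ≡⟨ cong (λ b → odd x xor not b) (sym odd-t) ⟩
        odd x xor odd (suc t)    ≡⟨ sym (odd-+ x (suc t)) ⟩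
        odd (x + suc t)          ≡⟨ cong odd x+1+t≡N ⟩
        odd N                    ≡⟨ odd-N ⟩
        true                     ∎
        where open ≡-Reasoning
      x+1<N : suc x < N
      x+1<N = subst (suc x <_) x+1+t≡N (subst (_< x + suc t) (+-comm x 1) (+-monoʳ-< x (s≤s (odd⇒>0 odd-t))))
      1+x+k≡n : suc (x + (N + t)) ≡ n
      1+x+k≡n = begin
        suc (x + (N + t))        ≡⟨ sym (+-suc x (N + t)) ⟩
        x + suc (N + t)          ≡⟨ cong (x +_) (sym (+-suc N t)) ⟩
        x + (N + suc t)          ≡⟨ cong (x +_) (+-comm N (suc t)) ⟩
        x + (suc t + N)          ≡⟨ sym (+-assoc x (suc t) N) ⟩
        x + suc t + N            ≡⟨ cong (_+ N) x+1+t≡N ⟩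
        n                        ∎
        where open ≡-Reasoning

  apexes : Subset n
  apexes = tabulate (apex ∘ toℕ)

  ∣apexes∣ : ∣ apexes ∣ ≡ R + R
  ∣apexes∣ = trans (∣tabulate∣≡sum {n} (apex ∘ toℕ)) (trans (sum-allFin≡count n apex) count-apex)

  apexes-independent : Independent strip apexes
  apexes-independent u w u∈ w∈ = dec-false (adjacent? (toℕ u) (toℕ w)) λ
    { (inj₁ uw) → apex-independent (∈-tabulate⁻ (apex ∘ toℕ) u∈) (∈-tabulate⁻ (apex ∘ toℕ) w∈) uw
    ; (inj₂ wu) → apex-independent (∈-tabulate⁻ (apex ∘ toℕ) w∈) (∈-tabulate⁻ (apex ∘ toℕ) u∈) wu }

  apexes-monochromatic : ∀ c → Proper strip c → ∃[ i ] (∀ u → u ∈ apexes → c u ≡ i)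
  apexes-monochromatic c proper =
    colourAt 1 , λ u u∈ → trans (sym (colourAt-toℕ u)) (apex-colour (toℕ u) (toℕ<n u) (∈-tabulate⁻ (apex ∘ toℕ) u∈))
    where open Colouring c proper

  R≤n : R ≤ n
  R≤n = ≤-trans (m≤m+n R R) (≤-trans (n≤1+n _) (m≤m+n N N))

<-by-difference : ∀ {a b} d → b ≡ suc (a + d) → a < b
<-by-difference {a} d refl = s≤s (m≤m+n a d)

-- For R = 9 + m the strip has n = 4m + 38 vertices and 2m + 18 apexes.
strip-α-bound : ∀ m → let open Strip (9 + m) in n / 3 + 5 ≤ ∣ apexes ∣
strip-α-bound m = subst (n / 3 + 5 ≤_) (sym ∣apexes∣) (begin
  n / 3 + 5          ≤⟨ +-monoˡ-≤ 5 (s≤s⁻¹ (m<n*o⇒m/o<n {n} {14 + (m + m)} {3} (<-by-difference (3 + (m + m)) ([14+2m]*3≡1+n+[3+2m] m)))) ⟩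
  13 + (m + m) + 5   ≡⟨ 13+2m+5≡R+R m ⟩
  (9 + m) + (9 + m)  ∎)
  where
  open Strip (9 + m)
  open ≤-Reasoning
  [14+2m]*3≡1+n+[3+2m] : ∀ m → (14 + (m + m)) * 3 ≡ suc (suc ((9 + m) + (9 + m)) + suc ((9 + m) + (9 + m)) + (3 + (m + m)))
  [14+2m]*3≡1+n+[3+2m] = solve-∀
  13+2m+5≡R+R : ∀ m → 13 + (m + m) + 5 ≡ (9 + m) + (9 + m)
  13+2m+5≡R+R = solve-∀

strip-class-bound : ∀ m → let open Strip (9 + m) in (n + 2) / 3 < ∣ apexes ∣
strip-class-bound m = subst ((n + 2) / 3 <_) (sym ∣apexes∣)
  (m<n*o⇒m/o<n {n + 2} {(9 + m) + (9 + m)} {3} (<-by-difference (13 + (m + m)) ([R+R]*3≡1+n+2+[13+2m] m)))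
  where
  open Strip (9 + m)
  [R+R]*3≡1+n+2+[13+2m] : ∀ m → ((9 + m) + (9 + m)) * 3 ≡ suc (suc ((9 + m) + (9 + m)) + suc ((9 + m) + (9 + m)) + 2 + (13 + (m + m)))
  [R+R]*3≡1+n+2+[13+2m] = solve-∀

mainTheorem5 : ∀ (m : ℕ) → ∃[ n ] Σ (Graph n) λ G →
    m ≤ n
    × OuterplanarNearTriangulation G
    × MaxDegreeEq G 5
    × (∀ v → AlphaAtLeast G v (n / 3))
    × ¬ (∃[ c ] EquitableThreeColouring G c)
mainTheorem5 m =
  n , strip ,
  ≤-trans (m≤n+m m 9) R≤n ,
  strip-outerplanar (≤-trans (m≤m+n 3 (6 + m)) R≤n) ,
  (degree≤5 , max-degree-attained (≤-trans (m≤m+n 7 (2 + m)) R≤n)) ,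
  independent⇒AlphaAtLeast strip apexes-independent degree≤5 (strip-α-bound m) ,
  monochromatic⇒¬equitable strip apexes (strip-class-bound m) apexes-monochromatic
  where open Strip (9 + m)
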